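{- Let $\sigma$ be a signature, $\Delta$ a set of $\mathcal{CO}[\sigma]$-formulas, and $\varphi,\psi$ formulas such that $\varphi\sqcup\psi$ is a $\mathcal{CO}_{\sqcup}[\sigma]$-formula. If $\Delta\models^g\varphi\sqcup\psi$, then $\Delta\models^g\varphi$ or $\Delta\models^g\psi$. In particular, if $\models^g\varphi\sqcup\psi$, then $\models^g\varphi$ or $\models^g\psi$.
   Context: Signature $\sigma=(\mathrm{Dom},\mathrm{Ran})$, $\mathrm{Dom}$ nonempty finite, $\mathrm{Ran}(X)$ nonempty finite. $\mathbf X=\mathbf x$ abbreviates $X_1=x_1\wedge\dots\wedge X_n=x_n$, inconsistent if two conjuncts give one variable distinct values. Systems of functions $\mathcal F$: for $V\in\mathrm{En}(\mathcal F)\subseteq\mathrm{Dom}$, parents $PA^{\mathcal F}_V\subseteq\mathrm{Dom}\setminus\{V\}$ and $\mathcal F_V:\mathrm{Ran}(PA^{\mathcal F}_V)\to\mathrm{Ran}(V)$; recursive if the parent graph is acyclic. A generalized causal team is a set of pairs $(s,\mathcal F)$ with $\mathcal F$ recursive and $s$ an assignment ($s(X)\in\mathrm{Ran}(X)$) with $s(V)=\mathcal F_V(s(PA^{\mathcal F}_V))$ for all $V\in\mathrm{En}(\mathcal F)$. Intervention (consistent $\mathbf X=\mathbf x$): $\mathcal F_{\mathbf X=\mathbf x}$ restricts $\mathcal F$ to $\mathrm{En}(\mathcal F)\setminus\mathbf X$; $s^{\mathcal F}_{\mathbf X=\mathbf x}$ is $x_i$ on $X_i$, $s(V)$ on non-intervened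 exogenous $V$, recursively $\mathcal F_V(s^{\mathcal F}_{\mathbf X=\mathbf x}(PA^{\mathcal F}_V))$ on non-intervened endogenous $V$; $T_{\mathbf X=\mathbf x}=\{(s^{\mathcal F}_{\mathbf X=\mathbf x},\mathcal F_{\mathbf X=\mathbf x}):(s,\mathcal F)\in T\}$. $\mathcal{CO}[\sigma]$: $\alpha::=X=x\mid\neg\alpha\mid\alpha\wedge\alpha\mid\alpha\vee\alpha\mid\mathbf X=\mathbf x\;\Box\!\!\rightarrow\alpha$; $\mathcal{CO}_{\sqcup}[\sigma]$: $\varphi::=X=x\mid\neg\alpha\mid\varphi\wedge\varphi\mid\varphi\vee\varphi\mid\varphi\sqcup\varphi\mid\mathbf X=\mathbf x\;\Box\!\!\rightarrow\varphi$ ($\alpha\in\mathcal{CO}[\sigma]$). Semantics: $T\models X=x$ iff $s(X)=x$ for all $(s,\mathcal F)\in T$; $T\models\neg\alpha$ iff $\{(s,\mathcal F)\}\not\models\alpha$ for all $(s,\mathcal F)\in T$; $\wedge$ usual; $T\models\varphi\vee\psi$ iff $T=T_1\cup T_2$ with $T_1\models\varphi$, $T_2\models\psi$; $T\models\varphi\sqcup\psi$ iff $T\models\varphi$ or $T\models\psi$; $T\models\mathbf X=\mathbf x\;\Box\!\!\rightarrow\varphi$ iff $\mathbf X=\mathbf x$ inconsistent or $T_{\mathbf X=\mathbf x}\models\varphi$. $\Delta\models^g\varphi$: every generalized causal team over $\sigma$ satisfying $\Delta$ satisfies $\varphi$. -}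

module Defs where

open import Data.Nat using (ℕ) renaming (suc to sucℕ)
open import Data.Fin using (Fin; _≟_)
open import Data.Bool using (Bool; true; false; _∧_; not; T)
open import Data.Product using (Σ; _×_; _,_; proj₁; proj₂)
open import Data.Sum using (_⊎_)
open import Data.Empty using (⊥)
open import Data.List using (List)
open import Data.Bool.ListAction using (any)
open import Data.List.NonEmpty using (List⁺; toList)
open import Data.List.Membership.Propositional using (_∈_)
open import Relation.Nullary using (¬_)
open import Level using (Lift; 0ℓ; suc)

open import Relation.Nullary.Decidable using (⌊_⌋)
open import Relation.Binary.PropositionalEquality using (_≡_)
open import Relation.Binary.Construct.Closure.Transitive using (TransClosure)

-- A signature: Dom = Fin (sucℕ dom) (nonempty, finite);
-- Ran(X) = Fin (sucℕ (ran X)) (nonempty, finite).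
record Sig : Set where
  field
    dom : ℕ
    ran : Fin (sucℕ dom) → ℕ

Lift' : Set → Set₁
Lift' A = Lift (suc 0ℓ) A

module _ (σ : Sig) where
  open Sig σ

  Var : Set
  Var = Fin (sucℕ dom)

  Val : Var → Set
  Val X = Fin (sucℕ (ran X))

  Assignment : Set
  Assignment = (X : Var) → Val X

  -- A system of functions: endogenous set En ⊆ Dom (as a Boolean predicate),
  -- for each endogenous V a parent set PA_V ⊆ Dom ∖ {V}, and
  -- F_V : Ran(PA_V) → Ran(V), where Ran(PA_V) = assignments on PA_V.
  record System : Set where
    field
      en    : Var → Bool
      pa    : (V : Var) → T (en V) → Var → Bool
      paIrr : (V : Var) (e : T (en V)) → pa V e V ≡ false
      fn    : (V : Var) (e : T (en V)) → ((W : Var) → T (pa V e W) → Val W) → Val V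
  open System public

  Edge : System → Var → Var → Set
  Edge F W V = Σ (T (en F V)) λ e → T (pa F V e W)

  Recursive : System → Set
  Recursive F = (V : Var) → ¬ TransClosure (Edge F) V V

  Pair : Set
  Pair = Assignment × System

  Compatible : Pair → Set
  Compatible (s , F) = (V : Var) (e : T (en F V)) → s V ≡ fn F V e (λ W _ → s W)

  Team : Set₁
  Team = Pair → Set

  GeneralizedCausalTeam : Team → Set
  GeneralizedCausalTeam Tm = (p : Pair) → Tm p → Recursive (proj₂ p) × Compatible p

  singleton : Pair → Team
  singleton p q = q ≡ p

  IsUnion : Team → Team → Team → Set
  IsUnion Tm T₁ T₂ = (p : Pair) → (Tm p → T₁ p ⊎ T₂ p) × (T₁ p ⊎ T₂ p → Tm p)

  -- an intervention  X₁ = x₁ ∧ … ∧ Xₙ = xₙ  (n ≥ 1)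
  Intervention : Set
  Intervention = List⁺ (Σ Var Val)

  Consistent : Intervention → Set
  Consistent l = {X : Var} {x y : Val X} → (X , x) ∈ toList l → (X , y) ∈ toList l → x ≡ y

  memb : Var → Intervention → Bool
  memb X l = any (λ e → ⌊ proj₁ e ≟ X ⌋) (toList l)

  T-∧ˡ : {a b : Bool} → T (a ∧ b) → T a
  T-∧ˡ {true} _ = _

  restrict : Intervention → System → System
  restrict l F = record
    { en    = λ V → en F V ∧ not (memb V l)
    ; pa    = λ V e → pa F V (T-∧ˡ e)
    ; paIrr = λ V e → paIrr F V (T-∧ˡ e)
    ; fn    = λ V e → fn F V (T-∧ˡ e)
    }

  -- s' = s^F_{X=x}: x_i on X_i, s(V) on non-intervened exogenous V, and
  -- F_V(s'(PA_V)) on non-intervened endogenous V.  (For recursive F this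
  -- system of equations has exactly one solution, namely the recursively
  -- defined assignment of the paper.)
  IsIntervened : Intervention → Pair → Assignment → Set
  IsIntervened l (s , F) s' = (X : Var) →
      (T (memb X l) → (X , s' X) ∈ toList l)
    × (¬ T (memb X l) → ((e : T (en F X)) → s' X ≡ fn F X e (λ W _ → s' W))
                      × (¬ T (en F X) → s' X ≡ s X))

  intervene : Intervention → Team → Team
  intervene l Tm (s' , F') =
    Σ Pair λ p → Tm p × (F' ≡ restrict l (proj₂ p)) × IsIntervened l p s'

  data CO : Set where
    atom : (X : Var) → Val X → CO
    neg  : CO → CO
    and  : CO → CO → CO
    or   : CO → CO → CO
    cf   : Intervention → CO → CO

  data COu : Set where
    atom : (X : Var) → Val X → COu
    neg  : CO → COu
    and  : COu → COu → COu
    or   : COu → COu → COu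
    gor  : COu → COu → COu
    cf   : Intervention → COu → COu

  _⊨_ : Team → CO → Set₁
  Tm ⊨ atom X x = (p : Pair) → Tm p → Lift' (proj₁ p X ≡ x)
  Tm ⊨ neg α    = (p : Pair) → Tm p → ¬ (singleton p ⊨ α)
  Tm ⊨ and α β  = (Tm ⊨ α) × (Tm ⊨ β)
  Tm ⊨ or α β   = Σ Team λ T₁ → Σ Team λ T₂ → Lift' (IsUnion Tm T₁ T₂) × (T₁ ⊨ α) × (T₂ ⊨ β)
  Tm ⊨ cf l α   = Lift' (¬ Consistent l) ⊎ (intervene l Tm ⊨ α)

  _⊨ᵘ_ : Team → COu → Set₁
  Tm ⊨ᵘ atom X x = (p : Pair) → Tm p → Lift' (proj₁ p X ≡ x)
  Tm ⊨ᵘ neg α    = (p : Pair) → Tm p → ¬ (singleton p ⊨ α)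
  Tm ⊨ᵘ and φ ψ  = (Tm ⊨ᵘ φ) × (Tm ⊨ᵘ ψ)
  Tm ⊨ᵘ or φ ψ   = Σ Team λ T₁ → Σ Team λ T₂ → Lift' (IsUnion Tm T₁ T₂) × (T₁ ⊨ᵘ φ) × (T₂ ⊨ᵘ ψ)
  Tm ⊨ᵘ gor φ ψ  = (Tm ⊨ᵘ φ) ⊎ (Tm ⊨ᵘ ψ)
  Tm ⊨ᵘ cf l φ   = Lift' (¬ Consistent l) ⊎ (intervene l Tm ⊨ᵘ φ)

  _⊨g_ : (CO → Set) → COu → Set₁
  Δ ⊨g φ = (Tm : Team) → GeneralizedCausalTeam Tm →
           ((α : CO) → Δ α → Tm ⊨ α) → Tm ⊨ᵘ φ

  ∅ : CO → Set
  ∅ _ = ⊥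

-- CO[σ]-formulas are flat: a team satisfies α iff each of its pairs does. Hence,
-- given Δ, the team of all recursive compatible pairs satisfying Δ pointwise is the
-- largest generalized causal team satisfying Δ. Every CO_⊔[σ]-formula is downward
-- closed, so whichever disjunct of φ ⊔ ψ this largest team satisfies is satisfied
-- by every generalized causal team satisfying Δ.
module Submission where

open import Defs
open import Data.Product using (Σ; _×_; _,_; proj₁; proj₂)
open import Data.Sum using (_⊎_; inj₁; inj₂; [_,_])
import Data.Sum as Sum
open import Data.Empty using (⊥-elim)
open import Data.List.NonEmpty using (toList)
open import Data.List.Membership.Propositional using (_∈_)
open import Data.List.Relation.Unary.All as All using (all?)
open import Data.Fin using (_≟_)
open import Relation.Nullary using (¬_; Dec; yes; no)
open import Relation.Binary.PropositionalEquality using (_≡_; refl; subst)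
open import Level using (lift; lower)

module _ (σ : Sig) where

  Agree : Σ (Var σ) (Val σ) → Σ (Var σ) (Val σ) → Set
  Agree (X , x) (Y , y) = (X≡Y : X ≡ Y) → subst (Val σ) X≡Y x ≡ y

  agree? : (a b : Σ (Var σ) (Val σ)) → Dec (Agree a b)
  agree? (X , x) (Y , y) with X ≟ Y
  ... | no X≢Y = yes λ X≡Y → ⊥-elim (X≢Y X≡Y)
  agree? (X , x) (.X , y) | yes refl with x ≟ y
  ... | yes x≡y = yes λ { refl → x≡y }
  ... | no x≢y  = no λ agree → x≢y (agree refl)

  consistent? : (l : Intervention σ) → Dec (Consistent σ l)
  consistent? l with all? (λ a → all? (agree? a) (toList l)) (toList l)
  ... | yes agreeAll = yes λ x∈ y∈ → All.lookup (All.lookup agreeAll x∈) y∈ refl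
  ... | no ¬agreeAll = no λ cons →
          ¬agreeAll (All.tabulate λ a∈ → All.tabulate λ b∈ → consistent⇒agree cons a∈ b∈)
    where
    consistent⇒agree : Consistent σ l → ∀ {a b} → a ∈ toList l → b ∈ toList l → Agree a b
    consistent⇒agree cons x∈ y∈ refl = cons x∈ y∈

  _⊆_ : Team σ → Team σ → Set
  T ⊆ T′ = (p : Pair σ) → T p → T′ p

  _∩_ : Team σ → Team σ → Team σ
  (T ∩ T′) p = T p × T′ p

  ∩-isUnion : (T A B : Team σ) → ((p : Pair σ) → T p → A p ⊎ B p) →
              IsUnion σ T (T ∩ A) (T ∩ B)
  ∩-isUnion T A B split p =
    (λ t → Sum.map (t ,_) (t ,_) (split p t)) , [ proj₁ , proj₁ ]

  intervene-mono : (l : Intervention σ) {T T′ : Team σ} → T ⊆ T′ →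
                   intervene σ l T ⊆ intervene σ l T′
  intervene-mono l T⊆T′ q (p , t , rest) = p , T⊆T′ p t , rest

  -- A counterfactual quantifies over every pair of the intervened singleton team, since
  -- s^F_{X=x} is only specified relationally and its uniqueness is not assumed.
  _⊩_ : Pair σ → CO σ → Set
  p ⊩ atom X x = proj₁ p X ≡ x
  p ⊩ neg α    = ¬ p ⊩ α
  p ⊩ and α β  = p ⊩ α × p ⊩ β
  p ⊩ or α β   = p ⊩ α ⊎ p ⊩ β
  p ⊩ cf l α   = ¬ Consistent σ l ⊎ ((q : Pair σ) → intervene σ l (singleton σ p) q → q ⊩ α)

  Pointwise : Team σ → CO σ → Set
  Pointwise T α = (p : Pair σ) → T p → p ⊩ α

  ⊨⇒pointwise : (T : Team σ) (α : CO σ) → _⊨_ σ T α → Pointwise T α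
  pointwise⇒⊨ : (T : Team σ) (α : CO σ) → Pointwise T α → _⊨_ σ T α

  ⊨⇒pointwise T (atom X x) T⊨ p t = lower (T⊨ p t)
  ⊨⇒pointwise T (neg α) T⊨ p t p⊩α = T⊨ p t (pointwise⇒⊨ (singleton σ p) α λ { _ refl → p⊩α })
  ⊨⇒pointwise T (and α β) (T⊨α , T⊨β) p t =
    ⊨⇒pointwise T α T⊨α p t , ⊨⇒pointwise T β T⊨β p t
  ⊨⇒pointwise T (or α β) (T₁ , T₂ , lift T≡T₁∪T₂ , T₁⊨α , T₂⊨β) p t =
    Sum.map (⊨⇒pointwise T₁ α T₁⊨α p) (⊨⇒pointwise T₂ β T₂⊨β p) (proj₁ (T≡T₁∪T₂ p) t)
  ⊨⇒pointwise T (cf l α) (inj₁ (lift inconsistent)) p t = inj₁ inconsistent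
  ⊨⇒pointwise T (cf l α) (inj₂ T⊨α) p t =
    inj₂ λ { q (p , refl , rest) → ⊨⇒pointwise (intervene σ l T) α T⊨α q (p , t , rest) }

  pointwise⇒⊨ T (atom X x) T⊩ p t = lift (T⊩ p t)
  pointwise⇒⊨ T (neg α) T⊩ p t p⊨α = T⊩ p t (⊨⇒pointwise (singleton σ p) α p⊨α p refl)
  pointwise⇒⊨ T (and α β) T⊩ =
    pointwise⇒⊨ T α (λ p t → proj₁ (T⊩ p t)) , pointwise⇒⊨ T β (λ p t → proj₂ (T⊩ p t))
  pointwise⇒⊨ T (or α β) T⊩ =
    (T ∩ (_⊩ α)) , (T ∩ (_⊩ β)) , lift (∩-isUnion T (_⊩ α) (_⊩ β) T⊩) ,
    pointwise⇒⊨ _ α (λ _ → proj₂) , pointwise⇒⊨ _ β (λ _ → proj₂)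
  pointwise⇒⊨ T (cf l α) T⊩ with consistent? l
  ... | no inconsistent = inj₁ (lift inconsistent)
  ... | yes consistent  = inj₂ (pointwise⇒⊨ (intervene σ l T) α λ { q (p , t , rest) →
          intervened⊩ q p rest (T⊩ p t) })
    where
    intervened⊩ : ∀ q p → (proj₂ q ≡ restrict σ l (proj₂ p)) × IsIntervened σ l p (proj₁ q) →
                  p ⊩ cf l α → q ⊩ α
    intervened⊩ q p rest (inj₁ inconsistent) = ⊥-elim (inconsistent consistent)
    intervened⊩ q p rest (inj₂ p⊩α)          = p⊩α q (p , refl , rest)

  ⊨ᵘ-downward-closed : (φ : COu σ) {T T′ : Team σ} → T ⊆ T′ → _⊨ᵘ_ σ T′ φ → _⊨ᵘ_ σ T φ
  ⊨ᵘ-downward-closed (atom X x) T⊆T′ T′⊨ p t = T′⊨ p (T⊆T′ p t)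
  ⊨ᵘ-downward-closed (neg α) T⊆T′ T′⊨ p t = T′⊨ p (T⊆T′ p t)
  ⊨ᵘ-downward-closed (and φ ψ) T⊆T′ (T′⊨φ , T′⊨ψ) =
    ⊨ᵘ-downward-closed φ T⊆T′ T′⊨φ , ⊨ᵘ-downward-closed ψ T⊆T′ T′⊨ψ
  ⊨ᵘ-downward-closed (or φ ψ) {T} T⊆T′ (T₁ , T₂ , lift T′≡T₁∪T₂ , T₁⊨φ , T₂⊨ψ) =
    (T ∩ T₁) , (T ∩ T₂) ,
    lift (∩-isUnion T T₁ T₂ λ p t → proj₁ (T′≡T₁∪T₂ p) (T⊆T′ p t)) ,
    ⊨ᵘ-downward-closed φ (λ _ → proj₂) T₁⊨φ , ⊨ᵘ-downward-closed ψ (λ _ → proj₂) T₂⊨ψ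
  ⊨ᵘ-downward-closed (gor φ ψ) T⊆T′ =
    Sum.map (⊨ᵘ-downward-closed φ T⊆T′) (⊨ᵘ-downward-closed ψ T⊆T′)
  ⊨ᵘ-downward-closed (cf l φ) T⊆T′ =
    Sum.map₂ (⊨ᵘ-downward-closed φ (intervene-mono l T⊆T′))

  largestTeam : (CO σ → Set) → Team σ
  largestTeam Δ p = (Recursive σ (proj₂ p) × Compatible σ p) × ((α : CO σ) → Δ α → p ⊩ α)

  largestTeam-gct : (Δ : CO σ → Set) → GeneralizedCausalTeam σ (largestTeam Δ)
  largestTeam-gct Δ _ = proj₁

  largestTeam-⊨ : (Δ : CO σ → Set) (α : CO σ) → Δ α → _⊨_ σ (largestTeam Δ) α
  largestTeam-⊨ Δ α α∈Δ = pointwise⇒⊨ (largestTeam Δ) α λ _ p∈ → proj₂ p∈ α α∈Δ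

  ⊆-largestTeam : (Δ : CO σ → Set) (T : Team σ) → GeneralizedCausalTeam σ T →
                  ((α : CO σ) → Δ α → _⊨_ σ T α) → T ⊆ largestTeam Δ
  ⊆-largestTeam Δ T gct T⊨Δ p t = gct p t , λ α α∈Δ → ⊨⇒pointwise T α (T⊨Δ α α∈Δ) p t

  ⊨g-entailed-by-largestTeam : (Δ : CO σ → Set) (φ : COu σ) →
                               _⊨ᵘ_ σ (largestTeam Δ) φ → _⊨g_ σ Δ φ
  ⊨g-entailed-by-largestTeam Δ φ largest⊨φ T gct T⊨Δ =
    ⊨ᵘ-downward-closed φ (⊆-largestTeam Δ T gct T⊨Δ) largest⊨φ

  ⊨g-gor-disjunction : (Δ : CO σ → Set) (φ ψ : COu σ) →
                       _⊨g_ σ Δ (gor φ ψ) → _⊨g_ σ Δ φ ⊎ _⊨g_ σ Δ ψ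
  ⊨g-gor-disjunction Δ φ ψ Δ⊨φ⊔ψ =
    Sum.map (⊨g-entailed-by-largestTeam Δ φ) (⊨g-entailed-by-largestTeam Δ ψ)
            (Δ⊨φ⊔ψ (largestTeam Δ) (largestTeam-gct Δ) (largestTeam-⊨ Δ))

theorem3p8 : (σ : Sig) →
    ((Δ : CO σ → Set) (φ ψ : COu σ) →
       _⊨g_ σ Δ (gor φ ψ) → _⊨g_ σ Δ φ ⊎ _⊨g_ σ Δ ψ)
    × ((φ ψ : COu σ) →
       _⊨g_ σ (∅ σ) (gor φ ψ) → _⊨g_ σ (∅ σ) φ ⊎ _⊨g_ σ (∅ σ) ψ)
theorem3p8 σ = ⊨g-gor-disjunction σ , ⊨g-gor-disjunction σ (∅ σ)
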